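{- Let $n \ge 3$ and let $S$ be a set of transpositions generating $S_n$ such that the Cayley graph $X=\mathrm{Cay}(S_n,S)$ is normal. Then $\mathrm{Aut}(X)$ is isomorphic to the direct product $S_n \times \mathrm{Aut}(T(S))$, where $T(S)$ is the transposition graph of $S$.
   Context: For a group $H$ and $S \subseteq H$ with $1 \notin S = S^{ -1}$, $\mathrm{Cay}(H,S)$ is the simple undirected graph with vertex set $H$ in which $h$ and $sh$ are adjacent for all $h \in H$, $s\in S$. The right regular representation $R(H)$ consists of the permutations $x \mapsto xa$ of $H$, $a \in H$; these are automorphisms of $\mathrm{Cay}(H,S)$. The Cayley graph is called normal if $R(H)$ is a normal subgroup of its full automorphism group $\mathrm{Aut}(\mathrm{Cay}(H,S))$. For a set $S$ of transpositions in $S_n$, the transposition graph $T(S)$ is the graph with vertex set $\{1,\ldots,n\}$ in which $i$ and $j$ are adjacent iff $(i,j) \in S$; $\mathrm{Aut}(T(S))$ is its automorphism group (a subgroup of $S_n$). -}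

module Defs where

open import Level using (0ℓ)
open import Data.Nat using (ℕ)
open import Data.Fin using (Fin)
open import Data.Fin.Permutation as P using (Permutation′; _⟨$⟩ʳ_; _⟨$⟩ˡ_; _∘ₚ_; transpose)
open import Data.Product using (Σ; ∃; ∃₂; _×_; _,_; proj₁; proj₂)
open import Data.Sum using (_⊎_)
open import Data.List using (List; []; _∷_)
open import Data.List.Relation.Unary.All using (All)
open import Relation.Binary.PropositionalEquality using (_≡_; _≢_; refl; sym; trans)
open import Relation.Binary.Bundles using (Setoid)
open import Algebra.Bundles.Raw using (RawGroup)
open import Function.Bundles using (Inverse)
import Function.Construct.Composition as Comp
import Function.Construct.Identity as Ident
import Function.Construct.Symmetry as Symm

-- The symmetric group S_n on {0,…,n-1} (= Fin n).
-- Elements are bijections of Fin n; equality is pointwise.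
-- Product convention: (σ · τ)(i) = σ (τ i)  (apply τ first).

Perm : ℕ → Set
Perm n = Permutation′ n

infix 4 _≈ₚ_
_≈ₚ_ : ∀ {n} → Perm n → Perm n → Set
σ ≈ₚ τ = ∀ i → σ ⟨$⟩ʳ i ≡ τ ⟨$⟩ʳ i

infixl 7 _·_
_·_ : ∀ {n} → Perm n → Perm n → Perm n
σ · τ = τ ∘ₚ σ

PermSetoid : ℕ → Setoid 0ℓ 0ℓ
PermSetoid n = record
  { Carrier = Perm n
  ; _≈_ = _≈ₚ_
  ; isEquivalence = record
    { refl = λ i → refl
    ; sym = λ p i → sym (p i)
    ; trans = λ p q i → trans (p i) (q i) } }

SymGroup : ℕ → RawGroup 0ℓ 0ℓ
SymGroup n = record
  { Carrier = Perm n ; _≈_ = _≈ₚ_ ; _∙_ = _·_ ; ε = P.id ; _⁻¹ = P.flip }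

record IsTranspositionSet {n : ℕ} (S : Perm n → Set) : Set where
  field
    respects : ∀ {σ τ} → σ ≈ₚ τ → S σ → S τ
    transp   : ∀ σ → S σ → ∃₂ λ i j → i ≢ j × σ ≈ₚ transpose i j

prod : ∀ {n} → List (Perm n) → Perm n
prod []       = P.id
prod (σ ∷ w)  = σ · prod w

Generates : ∀ {n} → (Perm n → Set) → Set
Generates {n} S = ∀ (σ : Perm n) →
  ∃ λ (w : List (Perm n)) → All (λ s → S s ⊎ S (P.flip s)) w × σ ≈ₚ prod w

module Cayley (n : ℕ) (S : Perm n → Set) where

  AdjX : Perm n → Perm n → Set
  AdjX h k = ∃ λ s → S s × k ≈ₚ s · h

  record AutX : Set where
    field
      bij     : Inverse (PermSetoid n) (PermSetoid n)
      pres    : ∀ h k → AdjX h k → AdjX (Inverse.to bij h) (Inverse.to bij k)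
      presInv : ∀ h k → AdjX h k → AdjX (Inverse.from bij h) (Inverse.from bij k)

  open AutX

  AutXGroup : RawGroup 0ℓ 0ℓ
  AutXGroup = record
    { Carrier = AutX
    ; _≈_ = λ φ ψ → ∀ x → Inverse.to (bij φ) x ≈ₚ Inverse.to (bij ψ) x
    ; _∙_ = λ φ ψ → record
        { bij = Comp.inverse (bij ψ) (bij φ)
        ; pres = λ h k a → pres φ _ _ (pres ψ h k a)
        ; presInv = λ h k a → presInv ψ _ _ (presInv φ h k a) }
    ; ε = record
        { bij = Ident.inverse (PermSetoid n)
        ; pres = λ h k a → a
        ; presInv = λ h k a → a }
    ; _⁻¹ = λ φ → record
        { bij = Symm.inverse (bij φ)
        ; pres = presInv φ
        ; presInv = pres φ } }

  -- R(S_n) is normal in Aut(X): for every φ ∈ Aut(X) and a ∈ S_n,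
  -- φ ∘ R_a ∘ φ⁻¹ = R_b for some b ∈ S_n, where R_a x = x · a.
  IsNormal : Set
  IsNormal = ∀ (φ : AutX) (a : Perm n) → ∃ λ (b : Perm n) →
    ∀ x → Inverse.to (bij φ) (Inverse.from (bij φ) x · a) ≈ₚ x · b

  AdjT : Fin n → Fin n → Set
  AdjT i j = S (transpose i j)

  record AutT : Set where
    field
      perm    : Perm n
      pres    : ∀ i j → AdjT i j → AdjT (perm ⟨$⟩ʳ i) (perm ⟨$⟩ʳ j)
      presInv : ∀ i j → AdjT i j → AdjT (perm ⟨$⟩ˡ i) (perm ⟨$⟩ˡ j)

  AutTGroup : RawGroup 0ℓ 0ℓ
  AutTGroup = record
    { Carrier = AutT
    ; _≈_ = λ π ρ → AutT.perm π ≈ₚ AutT.perm ρ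
    ; _∙_ = λ π ρ → record
        { perm = AutT.perm π · AutT.perm ρ
        ; pres = λ i j a → AutT.pres π _ _ (AutT.pres ρ i j a)
        ; presInv = λ i j a → AutT.presInv ρ _ _ (AutT.presInv π i j a) }
    ; ε = record { perm = P.id ; pres = λ i j a → a ; presInv = λ i j a → a }
    ; _⁻¹ = λ π → record
        { perm = P.flip (AutT.perm π)
        ; pres = AutT.presInv π
        ; presInv = AutT.pres π } }

-- Let φ ∈ Aut(X), F its underlying map and c = F 1. Normality says F (y · a) = F y · b
-- with b independent of y, which makes ψ x = F x · c⁻¹ an automorphism of S_n; since φ
-- maps the edge {1, s} to an edge at c, ψ maps S into S, and so does ψ⁻¹. Every
-- transposition is conjugate to an element of S, so ψ maps transpositions to
-- transpositions. For n ≥ 3 such an automorphism is conjugation by a permutation π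
-- (π i is the unique point moved by all ψ (i l)), and π ∈ Aut(T(S)). Hence
-- F x = π · x · h⁻¹ with h = c⁻¹ · π, and φ ↦ (h , π) is the isomorphism. The pair is
-- unique because the centre of S_n is trivial, and uniqueness reduces every group law
-- to exhibiting a representation of the composite.

module Submission where

open import Defs
open import Data.Nat using (ℕ; _≤_; suc; s≤s; z≤n)
open import Data.Fin using (Fin)
open import Data.Fin.Patterns using (0F; 1F; 2F)
open import Data.Fin.Properties using (_≟_)
open import Data.Fin.Permutation as P using (_⟨$⟩ʳ_; _⟨$⟩ˡ_; transpose; permutation)
open import Data.Product using (∃; ∃₂; _×_; _,_; proj₁; proj₂)
open import Data.Sum using (_⊎_; inj₁; inj₂)
open import Data.Empty using (⊥-elim)
open import Data.List using ([]; _∷_)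
open import Data.List.Relation.Unary.All using (_∷_)
open import Relation.Nullary using (¬_; yes; no)
open import Relation.Nullary.Decidable using (dec-true; dec-false)
open import Relation.Binary.PropositionalEquality
open import Function using (_∘_)
open import Function.Bundles using (Injection; Inverse)
open import Algebra.Bundles.Raw using (RawGroup)
open import Algebra.Construct.DirectProduct using (rawGroup)
open import Algebra.Morphism.Structures using (module GroupMorphisms)
open import Function.Properties.Inverse using (↔⇒↣)

-- Permutations and transpositions

module _ {n : ℕ} where

  ⟨$⟩ʳ-injective : (σ : Perm n) → ∀ {i j} → σ ⟨$⟩ʳ i ≡ σ ⟨$⟩ʳ j → i ≡ j
  ⟨$⟩ʳ-injective σ = Injection.injective (↔⇒↣ σ)

  ⟨$⟩ʳ⇒⟨$⟩ˡ : (σ : Perm n) → ∀ {i j} → σ ⟨$⟩ʳ i ≡ j → σ ⟨$⟩ˡ j ≡ i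
  ⟨$⟩ʳ⇒⟨$⟩ˡ σ refl = P.inverseˡ σ

  transpose-applyˡ : (i j : Fin n) → transpose i j ⟨$⟩ʳ i ≡ j
  transpose-applyˡ i j rewrite dec-true (i ≟ i) refl = refl

  transpose-applyʳ : (i j : Fin n) → transpose i j ⟨$⟩ʳ j ≡ i
  transpose-applyʳ i j with j ≟ i
  ... | yes refl = refl
  ... | no j≢i rewrite dec-true (j ≟ j) refl = refl

  transpose-fix : (i j : Fin n) {k : Fin n} → k ≢ i → k ≢ j → transpose i j ⟨$⟩ʳ k ≡ k
  transpose-fix i j {k} k≢i k≢j rewrite dec-false (k ≟ i) k≢i | dec-false (k ≟ j) k≢j = refl

  data TransposeView (i j : Fin n) : Fin n → Set where
    at-i      : TransposeView i j i
    at-j      : TransposeView i j j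
    elsewhere : ∀ {k} → k ≢ i → k ≢ j → TransposeView i j k

  transpose-view : (i j k : Fin n) → TransposeView i j k
  transpose-view i j k with k ≟ i | k ≟ j
  ... | yes refl | _        = at-i
  ... | no _     | yes refl = at-j
  ... | no k≢i   | no k≢j   = elsewhere k≢i k≢j

  transpose-conjugate : (σ : Perm n) (i j : Fin n) →
    σ · transpose i j ≈ₚ transpose (σ ⟨$⟩ʳ i) (σ ⟨$⟩ʳ j) · σ
  transpose-conjugate σ i j k with transpose-view i j k
  ... | at-i = trans (cong (σ ⟨$⟩ʳ_) (transpose-applyˡ i j))
                     (sym (transpose-applyˡ (σ ⟨$⟩ʳ i) (σ ⟨$⟩ʳ j)))
  ... | at-j = trans (cong (σ ⟨$⟩ʳ_) (transpose-applyʳ i j))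
                     (sym (transpose-applyʳ (σ ⟨$⟩ʳ i) (σ ⟨$⟩ʳ j)))
  ... | elsewhere k≢i k≢j = trans (cong (σ ⟨$⟩ʳ_) (transpose-fix i j k≢i k≢j))
    (sym (transpose-fix (σ ⟨$⟩ʳ i) (σ ⟨$⟩ʳ j) (k≢i ∘ ⟨$⟩ʳ-injective σ) (k≢j ∘ ⟨$⟩ʳ-injective σ)))

  transpose-conjugate′ : (σ : Perm n) (i j : Fin n) →
    σ · transpose i j · P.flip σ ≈ₚ transpose (σ ⟨$⟩ʳ i) (σ ⟨$⟩ʳ j)
  transpose-conjugate′ σ i j k =
    trans (transpose-conjugate σ i j (σ ⟨$⟩ˡ k))
          (cong (transpose (σ ⟨$⟩ʳ i) (σ ⟨$⟩ʳ j) ⟨$⟩ʳ_) (P.inverseʳ σ))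

  transpose-sym : (i j : Fin n) → transpose i j ≈ₚ transpose j i
  transpose-sym i j k with transpose-view i j k
  ... | at-i = trans (transpose-applyˡ i j) (sym (transpose-applyʳ j i))
  ... | at-j = trans (transpose-applyʳ i j) (sym (transpose-applyˡ j i))
  ... | elsewhere k≢i k≢j = trans (transpose-fix i j k≢i k≢j) (sym (transpose-fix j i k≢j k≢i))

  transpose-involutive : (i j : Fin n) → transpose i j · transpose i j ≈ₚ P.id
  transpose-involutive i j k with transpose-view i j k
  ... | at-i = trans (cong (transpose i j ⟨$⟩ʳ_) (transpose-applyˡ i j)) (transpose-applyʳ i j)
  ... | at-j = trans (cong (transpose i j ⟨$⟩ʳ_) (transpose-applyʳ i j)) (transpose-applyˡ i j)
  ... | elsewhere k≢i k≢j = trans (cong (transpose i j ⟨$⟩ʳ_) (transpose-fix i j k≢i k≢j))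
                                  (transpose-fix i j k≢i k≢j)

  record Moves (σ : Perm n) (p : Fin n) : Set where
    constructor moves
    field moved : σ ⟨$⟩ʳ p ≢ p
  open Moves

  Moves-resp : ∀ {σ τ p} → σ ≈ₚ τ → Moves σ p → Moves τ p
  Moves-resp {p = p} σ≈τ (moves m) = moves (m ∘ trans (σ≈τ p))

  transpose-movesˡ : ∀ {i j} → i ≢ j → Moves (transpose i j) i
  transpose-movesˡ {i} {j} i≢j = moves (λ e → i≢j (trans (sym e) (transpose-applyˡ i j)))

  transpose-movesʳ : ∀ {i j} → i ≢ j → Moves (transpose i j) j
  transpose-movesʳ {i} {j} i≢j = moves (λ e → i≢j (trans (sym (transpose-applyʳ i j)) e))

  transpose-moved : ∀ {i j k} → Moves (transpose i j) k → k ≡ i ⊎ k ≡ j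
  transpose-moved {i} {j} {k} (moves m) with transpose-view i j k
  ... | at-i = inj₁ refl
  ... | at-j = inj₂ refl
  ... | elsewhere k≢i k≢j = ⊥-elim (m (transpose-fix i j k≢i k≢j))

  Moves-conjugate : ∀ {σ τ τ′ p} → σ · τ ≈ₚ τ′ · σ → Moves τ p → Moves τ′ (σ ⟨$⟩ʳ p)
  Moves-conjugate {σ} {p = p} στ≈τ′σ (moves m) =
    moves λ e → m (⟨$⟩ʳ-injective σ (trans (στ≈τ′σ p) e))

  record Commute (σ τ : Perm n) : Set where
    constructor commute
    field commutes : σ · τ ≈ₚ τ · σ
  open Commute

  Commute-resp : ∀ {σ σ′ τ τ′} → σ ≈ₚ σ′ → τ ≈ₚ τ′ → Commute σ′ τ′ → Commute σ τ
  Commute-resp {σ} {σ′} {τ} {τ′} σ≈ τ≈ (commute c) = commute λ k → begin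
    σ ⟨$⟩ʳ (τ ⟨$⟩ʳ k)    ≡⟨ cong (σ ⟨$⟩ʳ_) (τ≈ k) ⟩
    σ ⟨$⟩ʳ (τ′ ⟨$⟩ʳ k)   ≡⟨ σ≈ _ ⟩
    σ′ ⟨$⟩ʳ (τ′ ⟨$⟩ʳ k)  ≡⟨ c k ⟩
    τ′ ⟨$⟩ʳ (σ′ ⟨$⟩ʳ k)  ≡⟨ cong (τ′ ⟨$⟩ʳ_) (sym (σ≈ k)) ⟩
    τ′ ⟨$⟩ʳ (σ ⟨$⟩ʳ k)   ≡⟨ sym (τ≈ _) ⟩
    τ ⟨$⟩ʳ (σ ⟨$⟩ʳ k)    ∎
    where open ≡-Reasoning

  transpose-disjoint-commute : ∀ {a b c d} → a ≢ c → a ≢ d → b ≢ c → b ≢ d →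
    Commute (transpose a b) (transpose c d)
  transpose-disjoint-commute {a} {b} {c} {d} a≢c a≢d b≢c b≢d = commute λ k →
    trans (transpose-conjugate (transpose a b) c d k)
      (cong₂ (λ x y → transpose x y ⟨$⟩ʳ (transpose a b ⟨$⟩ʳ k))
        (transpose-fix a b (a≢c ∘ sym) (b≢c ∘ sym))
        (transpose-fix a b (a≢d ∘ sym) (b≢d ∘ sym)))

  IsTransposition : Perm n → Set
  IsTransposition σ = ∃₂ λ a b → a ≢ b × σ ≈ₚ transpose a b

  noncommuting⇒common-moved-point : ∀ {σ τ} → IsTransposition σ → IsTransposition τ →
    ¬ Commute σ τ → ∃ λ p → Moves σ p × Moves τ p
  noncommuting⇒common-moved-point (a , b , a≢b , σ≈) (c , d , c≢d , τ≈) ¬comm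
    with a ≟ c | a ≟ d | b ≟ c | b ≟ d
  ... | yes refl | _ | _ | _ =
    a , Moves-resp (sym ∘ σ≈) (transpose-movesˡ a≢b) , Moves-resp (sym ∘ τ≈) (transpose-movesˡ c≢d)
  ... | _ | yes refl | _ | _ =
    a , Moves-resp (sym ∘ σ≈) (transpose-movesˡ a≢b) , Moves-resp (sym ∘ τ≈) (transpose-movesʳ c≢d)
  ... | _ | _ | yes refl | _ =
    b , Moves-resp (sym ∘ σ≈) (transpose-movesʳ a≢b) , Moves-resp (sym ∘ τ≈) (transpose-movesˡ c≢d)
  ... | _ | _ | _ | yes refl =
    b , Moves-resp (sym ∘ σ≈) (transpose-movesʳ a≢b) , Moves-resp (sym ∘ τ≈) (transpose-movesʳ c≢d)
  ... | no a≢c | no a≢d | no b≢c | no b≢d =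
    ⊥-elim (¬comm (Commute-resp σ≈ τ≈ (transpose-disjoint-commute a≢c a≢d b≢c b≢d)))

  transposition-through : ∀ {σ p} → IsTransposition σ → Moves σ p →
    ∃ λ q → p ≢ q × σ ≈ₚ transpose p q
  transposition-through (a , b , a≢b , σ≈) m with transpose-moved (Moves-resp σ≈ m)
  ... | inj₁ refl = b , a≢b , σ≈
  ... | inj₂ refl = a , a≢b ∘ sym , λ k → trans (σ≈ k) (transpose-sym a b k)

  transposition-determined : ∀ {σ p q} → IsTransposition σ → Moves σ p → Moves σ q → p ≢ q →
    σ ≈ₚ transpose p q
  transposition-determined t mp mq p≢q with transposition-through t mp
  ... | r , _ , σ≈ with transpose-moved (Moves-resp σ≈ mq)
  ...   | inj₁ q≡p = ⊥-elim (p≢q (sym q≡p))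
  ...   | inj₂ refl = σ≈

  transpose-conjugate-star : ∀ {p a b} → p ≢ b → a ≢ b →
    transpose p a · transpose p b · transpose p a ≈ₚ transpose a b
  transpose-conjugate-star {p} {a} {b} p≢b a≢b k = begin
    σ ⟨$⟩ʳ (transpose p b ⟨$⟩ʳ (σ ⟨$⟩ʳ k))
      ≡⟨ transpose-conjugate σ p b (σ ⟨$⟩ʳ k) ⟩
    transpose (σ ⟨$⟩ʳ p) (σ ⟨$⟩ʳ b) ⟨$⟩ʳ (σ ⟨$⟩ʳ (σ ⟨$⟩ʳ k))
      ≡⟨ cong₂ (λ x y → transpose x y ⟨$⟩ʳ (σ ⟨$⟩ʳ (σ ⟨$⟩ʳ k)))
           (transpose-applyˡ p a) (transpose-fix p a (p≢b ∘ sym) (a≢b ∘ sym)) ⟩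
    transpose a b ⟨$⟩ʳ (σ ⟨$⟩ʳ (σ ⟨$⟩ʳ k))
      ≡⟨ cong (transpose a b ⟨$⟩ʳ_) (transpose-involutive p a k) ⟩
    transpose a b ⟨$⟩ʳ k ∎
    where open ≡-Reasoning
          σ = transpose p a

  -- Three pairwise non-commuting transpositions either share a point or form a
  -- triangle, and then one is the conjugate of another by the third.
  star-or-triangle : ∀ {σ τ ρ p a b} → p ≢ a → σ ≈ₚ transpose p a → p ≢ b → τ ≈ₚ transpose p b →
    IsTransposition ρ → ¬ Commute σ τ → ¬ Commute σ ρ → ¬ Commute τ ρ →
    ¬ (σ · τ · σ ≈ₚ ρ) → Moves ρ p
  star-or-triangle {σ} {τ} {ρ} {p} {a} {b} p≢a σ≈ p≢b τ≈ ρ-tr ¬στ ¬σρ ¬τρ ¬triangle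
    with noncommuting⇒common-moved-point (p , a , p≢a , σ≈) ρ-tr ¬σρ
       | noncommuting⇒common-moved-point (p , b , p≢b , τ≈) ρ-tr ¬τρ
  ... | q , σq , ρq | r , τr , ρr
    with transpose-moved (Moves-resp σ≈ σq) | transpose-moved (Moves-resp τ≈ τr)
  ... | inj₁ refl | _ = ρq
  ... | inj₂ _ | inj₁ refl = ρr
  ... | inj₂ refl | inj₂ refl = ⊥-elim (¬triangle (λ k → begin
    σ ⟨$⟩ʳ (τ ⟨$⟩ʳ (σ ⟨$⟩ʳ k))
      ≡⟨ cong (σ ⟨$⟩ʳ_) (trans (cong (τ ⟨$⟩ʳ_) (σ≈ k)) (τ≈ _)) ⟩
    σ ⟨$⟩ʳ (transpose p b ⟨$⟩ʳ (transpose p a ⟨$⟩ʳ k))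
      ≡⟨ σ≈ _ ⟩
    (transpose p a · transpose p b · transpose p a) ⟨$⟩ʳ k
      ≡⟨ transpose-conjugate-star p≢b a≢b k ⟩
    transpose a b ⟨$⟩ʳ k
      ≡⟨ sym (transposition-determined ρ-tr ρq ρr a≢b k) ⟩
    ρ ⟨$⟩ʳ k ∎))
    where
    open ≡-Reasoning
    a≢b : a ≢ b
    a≢b refl = ¬στ (Commute-resp {σ′ = transpose p a} {τ′ = transpose p a} σ≈ τ≈
                                   (commute λ _ → refl))

  transpose-star-noncommuting : ∀ {i j k} → i ≢ j → i ≢ k → j ≢ k →
    ¬ Commute (transpose i j) (transpose i k)
  transpose-star-noncommuting {i} {j} {k} i≢j i≢k j≢k (commute c) = j≢k (begin
    j                        ≡⟨ sym (transpose-fix i k (i≢j ∘ sym) j≢k) ⟩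
    ik ⟨$⟩ʳ j                ≡⟨ cong (ik ⟨$⟩ʳ_) (sym (transpose-applyˡ i j)) ⟩
    ik ⟨$⟩ʳ (ij ⟨$⟩ʳ i)      ≡⟨ sym (c i) ⟩
    ij ⟨$⟩ʳ (ik ⟨$⟩ʳ i)      ≡⟨ cong (ij ⟨$⟩ʳ_) (transpose-applyˡ i k) ⟩
    ij ⟨$⟩ʳ k                ≡⟨ transpose-fix i j (i≢k ∘ sym) (j≢k ∘ sym) ⟩
    k                        ∎)
    where
    open ≡-Reasoning
    ij ik : Perm n
    ij = transpose i j
    ik = transpose i k

  left-invertible⇒injective : (h h′ : Perm n → Perm n) → (∀ {x y} → x ≈ₚ y → h′ x ≈ₚ h′ y) →
    (∀ x → h′ (h x) ≈ₚ x) → ∀ {x y} → h x ≈ₚ h y → x ≈ₚ y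
  left-invertible⇒injective h h′ h′-cong h′∘h≈id {x} {y} hx≈hy k =
    trans (sym (h′∘h≈id x k)) (trans (h′-cong hx≈hy k) (h′∘h≈id y k))

  flip-cong : ∀ {σ τ : Perm n} → σ ≈ₚ τ → P.flip σ ≈ₚ P.flip τ
  flip-cong {σ} {τ} σ≈τ k = sym (⟨$⟩ʳ⇒⟨$⟩ˡ τ (trans (sym (σ≈τ (σ ⟨$⟩ˡ k))) (P.inverseʳ σ)))

  flip-injective : ∀ {σ τ : Perm n} → P.flip σ ≈ₚ P.flip τ → σ ≈ₚ τ
  flip-injective {σ} {τ} σ⁻¹≈τ⁻¹ k =
    trans (sym (P.inverseʳ τ)) (cong (τ ⟨$⟩ʳ_) (trans (sym (σ⁻¹≈τ⁻¹ (σ ⟨$⟩ʳ k))) (P.inverseˡ σ)))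

  Intertwines : (Perm n → Perm n) → (Fin n → Fin n) → Set
  Intertwines f π = ∀ σ i → f σ ⟨$⟩ʳ π i ≡ π (σ ⟨$⟩ʳ i)

  intertwines⇒conjugation : ∀ {f} (π : Perm n) → Intertwines f (π ⟨$⟩ʳ_) →
    ∀ x → f x ≈ₚ π · x · P.flip π
  intertwines⇒conjugation {f} π fπ x k =
    trans (cong (f x ⟨$⟩ʳ_) (sym (P.inverseʳ π))) (fπ x (π ⟨$⟩ˡ k))

  intertwines-∘ : ∀ {f g α β} → Intertwines f α → Intertwines g β → Intertwines (f ∘ g) (α ∘ β)
  intertwines-∘ {f} {g} {α} {β} fα gβ σ i = trans (fα (g σ) (β i)) (cong α (gβ σ i))

-- The symmetric group on at least three points

module _ {m : ℕ} where
  private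
    N : ℕ
    N = suc (suc (suc m))

  third-point : (i j : Fin N) → ∃ λ k → k ≢ i × k ≢ j
  third-point i j with 0F ≟ i | 0F ≟ j
  ... | no 0≢i | no 0≢j = 0F , 0≢i , 0≢j
  ... | yes refl | _ with 1F ≟ j
  ...   | no 1≢j = 1F , (λ ()) , 1≢j
  ...   | yes refl = 2F , (λ ()) , (λ ())
  third-point i j | no _ | yes refl with 1F ≟ i
  ...   | no 1≢i = 1F , 1≢i , (λ ())
  ...   | yes refl = 2F , (λ ()) , (λ ())

  -- If h i ≢ i, pick k ∉ {i, h i}: then h i = h ((h i  k) i) = (h i  k) (h i) = k.
  commutes-with-all⇒id : (h : Fin N → Fin N) → (∀ (σ : Perm N) i → h (σ ⟨$⟩ʳ i) ≡ σ ⟨$⟩ʳ h i) →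
    ∀ i → h i ≡ i
  commutes-with-all⇒id h h-comm i with h i ≟ i
  ... | yes hi≡i = hi≡i
  ... | no hi≢i with third-point i (h i)
  ...   | k , k≢i , k≢hi = ⊥-elim (k≢hi (sym (begin
    h i                          ≡⟨ cong h (sym (transpose-fix (h i) k (hi≢i ∘ sym) (k≢i ∘ sym))) ⟩
    h (transpose (h i) k ⟨$⟩ʳ i)  ≡⟨ h-comm (transpose (h i) k) i ⟩
    transpose (h i) k ⟨$⟩ʳ h i    ≡⟨ transpose-applyˡ (h i) k ⟩
    k                            ∎)))
    where open ≡-Reasoning

  translations-unique : ∀ {τ σ τ′ σ′ : Perm N} → (∀ x → τ · x · σ ≈ₚ τ′ · x · σ′) →
    τ ≈ₚ τ′ × σ ≈ₚ σ′
  translations-unique {τ} {σ} {τ′} {σ′} eq = τ≈τ′ , σ≈σ′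
    where
    open ≡-Reasoning
    h : Fin N → Fin N
    h k = τ′ ⟨$⟩ˡ (τ ⟨$⟩ʳ k)
    σ′σ⁻¹≡h : ∀ k → σ′ ⟨$⟩ʳ (σ ⟨$⟩ˡ k) ≡ h k
    σ′σ⁻¹≡h k = sym (⟨$⟩ʳ⇒⟨$⟩ˡ τ′ (begin
      τ′ ⟨$⟩ʳ (σ′ ⟨$⟩ʳ (σ ⟨$⟩ˡ k)) ≡⟨ sym (eq P.id (σ ⟨$⟩ˡ k)) ⟩
      τ ⟨$⟩ʳ (σ ⟨$⟩ʳ (σ ⟨$⟩ˡ k))   ≡⟨ cong (τ ⟨$⟩ʳ_) (P.inverseʳ σ) ⟩
      τ ⟨$⟩ʳ k                     ∎))
    h-central : ∀ (x : Perm N) k → h (x ⟨$⟩ʳ k) ≡ x ⟨$⟩ʳ h k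
    h-central x k = ⟨$⟩ʳ⇒⟨$⟩ˡ τ′ (begin
      τ′ ⟨$⟩ʳ (x ⟨$⟩ʳ h k)                   ≡⟨ cong (λ j → τ′ ⟨$⟩ʳ (x ⟨$⟩ʳ j)) (sym (σ′σ⁻¹≡h k)) ⟩
      τ′ ⟨$⟩ʳ (x ⟨$⟩ʳ (σ′ ⟨$⟩ʳ (σ ⟨$⟩ˡ k)))  ≡⟨ sym (eq x (σ ⟨$⟩ˡ k)) ⟩
      τ ⟨$⟩ʳ (x ⟨$⟩ʳ (σ ⟨$⟩ʳ (σ ⟨$⟩ˡ k)))    ≡⟨ cong (λ j → τ ⟨$⟩ʳ (x ⟨$⟩ʳ j)) (P.inverseʳ σ) ⟩
      τ ⟨$⟩ʳ (x ⟨$⟩ʳ k)                      ∎)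
    τ≈τ′ : τ ≈ₚ τ′
    τ≈τ′ k = trans (sym (P.inverseʳ τ′)) (cong (τ′ ⟨$⟩ʳ_) (commutes-with-all⇒id h h-central k))
    σ≈σ′ : σ ≈ₚ σ′
    σ≈σ′ k = ⟨$⟩ʳ-injective τ (trans (eq P.id k) (sym (τ≈τ′ (σ′ ⟨$⟩ʳ k))))

  -- An injective endomorphism of S_N sending transpositions to transpositions is
  -- induced by a map of points: i ↦ the point moved by all f (i l), l ≢ i.
  module TranspositionPreserving (f : Perm N → Perm N)
    (f-cong : ∀ {x y} → x ≈ₚ y → f x ≈ₚ f y)
    (f-hom : ∀ x y → f (x · y) ≈ₚ f x · f y)
    (f-injective : ∀ {x y} → f x ≈ₚ f y → x ≈ₚ y)
    (f-transposition : ∀ {a b} → a ≢ b → IsTransposition (f (transpose a b)))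
    where

    f-noncommuting : ∀ {i j k} → i ≢ j → i ≢ k → j ≢ k →
      ¬ Commute (f (transpose i j)) (f (transpose i k))
    f-noncommuting {i} {j} {k} i≢j i≢k j≢k (commute c) =
      transpose-star-noncommuting i≢j i≢k j≢k (commute (f-injective λ l → begin
        f (transpose i j · transpose i k) ⟨$⟩ʳ l           ≡⟨ f-hom _ _ l ⟩
        (f (transpose i j) · f (transpose i k)) ⟨$⟩ʳ l     ≡⟨ c l ⟩
        (f (transpose i k) · f (transpose i j)) ⟨$⟩ʳ l     ≡⟨ sym (f-hom _ _ l) ⟩
        f (transpose i k · transpose i j) ⟨$⟩ʳ l           ∎))
      where open ≡-Reasoning

    j₀ k₀ : Fin N → Fin N
    j₀ i = proj₁ (third-point i i)
    k₀ i = proj₁ (third-point i (j₀ i))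

    i≢j₀ : ∀ i → i ≢ j₀ i
    i≢j₀ i = proj₁ (proj₂ (third-point i i)) ∘ sym

    i≢k₀ : ∀ i → i ≢ k₀ i
    i≢k₀ i = proj₁ (proj₂ (third-point i (j₀ i))) ∘ sym

    j₀≢k₀ : ∀ i → j₀ i ≢ k₀ i
    j₀≢k₀ i = proj₂ (proj₂ (third-point i (j₀ i))) ∘ sym

    ¬commute₀ : ∀ i → ¬ Commute (f (transpose i (j₀ i))) (f (transpose i (k₀ i)))
    ¬commute₀ i = f-noncommuting (i≢j₀ i) (i≢k₀ i) (j₀≢k₀ i)

    opaque
      centre : Fin N → Fin N
      centre i = proj₁ (noncommuting⇒common-moved-point
        (f-transposition (i≢j₀ i)) (f-transposition (i≢k₀ i)) (¬commute₀ i))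

      centre-moved₀ : ∀ i →
        Moves (f (transpose i (j₀ i))) (centre i) × Moves (f (transpose i (k₀ i))) (centre i)
      centre-moved₀ i = proj₂ (noncommuting⇒common-moved-point
        (f-transposition (i≢j₀ i)) (f-transposition (i≢k₀ i)) (¬commute₀ i))

    centre-moved : ∀ i l → i ≢ l → Moves (f (transpose i l)) (centre i)
    centre-moved i l i≢l with l ≟ j₀ i | l ≟ k₀ i
    ... | yes refl | _ = proj₁ (centre-moved₀ i)
    ... | no _ | yes refl = proj₂ (centre-moved₀ i)
    ... | no l≢j₀ | no l≢k₀
      with transposition-through (f-transposition (i≢j₀ i)) (proj₁ (centre-moved₀ i))
         | transposition-through (f-transposition (i≢k₀ i)) (proj₂ (centre-moved₀ i))
    ...   | a , c≢a , σ≈ | b , c≢b , τ≈ =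
      star-or-triangle c≢a σ≈ c≢b τ≈ (f-transposition i≢l) (¬commute₀ i)
        (f-noncommuting (i≢j₀ i) i≢l (l≢j₀ ∘ sym)) (f-noncommuting (i≢k₀ i) i≢l (l≢k₀ ∘ sym))
        ¬triangle
      where
      open ≡-Reasoning
      σ = transpose i (j₀ i)
      τ = transpose i (k₀ i)
      ¬triangle : ¬ (f σ · f τ · f σ ≈ₚ f (transpose i l))
      ¬triangle eq = i≢l (begin
        i                            ≡⟨ sym (transpose-fix (j₀ i) (k₀ i) (i≢j₀ i) (i≢k₀ i)) ⟩
        transpose (j₀ i) (k₀ i) ⟨$⟩ʳ i ≡⟨ sym (transpose-conjugate-star (i≢k₀ i) (j₀≢k₀ i) i) ⟩
        (σ · τ · σ) ⟨$⟩ʳ i           ≡⟨ f-injective triangle i ⟩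
        transpose i l ⟨$⟩ʳ i          ≡⟨ transpose-applyˡ i l ⟩
        l                            ∎)
        where
        triangle : f (σ · τ · σ) ≈ₚ f (transpose i l)
        triangle k = begin
          f (σ · τ · σ) ⟨$⟩ʳ k              ≡⟨ f-hom (σ · τ) σ k ⟩
          f (σ · τ) ⟨$⟩ʳ (f σ ⟨$⟩ʳ k)       ≡⟨ f-hom σ τ _ ⟩
          (f σ · f τ · f σ) ⟨$⟩ʳ k          ≡⟨ eq k ⟩
          f (transpose i l) ⟨$⟩ʳ k          ∎

    centre-unique : ∀ i q → (∀ l → i ≢ l → Moves (f (transpose i l)) q) → q ≡ centre i
    centre-unique i q q-moved with q ≟ centre i
    ... | yes q≡c = q≡c
    ... | no q≢c = ⊥-elim (j₀≢k₀ i (begin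
      j₀ i                              ≡⟨ sym (transpose-applyˡ i (j₀ i)) ⟩
      transpose i (j₀ i) ⟨$⟩ʳ i          ≡⟨ f-injective same i ⟩
      transpose i (k₀ i) ⟨$⟩ʳ i          ≡⟨ transpose-applyˡ i (k₀ i) ⟩
      k₀ i                              ∎))
      where
      open ≡-Reasoning
      determined : ∀ l → i ≢ l → f (transpose i l) ≈ₚ transpose q (centre i)
      determined l i≢l = transposition-determined (f-transposition i≢l)
        (q-moved l i≢l) (centre-moved i l i≢l) q≢c
      same : f (transpose i (j₀ i)) ≈ₚ f (transpose i (k₀ i))
      same k = trans (determined (j₀ i) (i≢j₀ i) k) (sym (determined (k₀ i) (i≢k₀ i) k))

    centre-intertwines : Intertwines f centre
    centre-intertwines x i = centre-unique (x ⟨$⟩ʳ i) (f x ⟨$⟩ʳ centre i) moved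
      where
      moved : ∀ l → x ⟨$⟩ʳ i ≢ l → Moves (f (transpose (x ⟨$⟩ʳ i) l)) (f x ⟨$⟩ʳ centre i)
      moved l xi≢l = subst (λ l′ → Moves (f (transpose (x ⟨$⟩ʳ i) l′)) (f x ⟨$⟩ʳ centre i))
        (P.inverseʳ x {l}) (Moves-conjugate {σ = f x} conj (centre-moved i j i≢j))
        where
        j = x ⟨$⟩ˡ l
        i≢j : i ≢ j
        i≢j i≡j = xi≢l (trans (cong (x ⟨$⟩ʳ_) i≡j) (P.inverseʳ x))
        conj : f x · f (transpose i j) ≈ₚ f (transpose (x ⟨$⟩ʳ i) (x ⟨$⟩ʳ j)) · f x
        conj k = trans (sym (f-hom x (transpose i j) k))
          (trans (f-cong (transpose-conjugate x i j) k) (f-hom _ x k))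

  intertwines-id⇒id : ∀ {f π} → (∀ x → f x ≈ₚ x) → Intertwines f π → ∀ i → π i ≡ i
  intertwines-id⇒id {f} {π} f≈id fπ = commutes-with-all⇒id π λ x i →
    trans (sym (fπ x i)) (f≈id x (π i))

  transpositions-conjugate : ∀ {a b c d : Fin N} → a ≢ b → c ≢ d →
    ∃ λ g → g ⟨$⟩ʳ a ≡ c × g ⟨$⟩ʳ b ≡ d
  transpositions-conjugate {a} {b} {c} {d} a≢b c≢d =
    transpose b′ d · transpose a c , ga≡c , transpose-applyˡ b′ d
    where
    b′ = transpose a c ⟨$⟩ʳ b
    ga≡c : transpose b′ d ⟨$⟩ʳ (transpose a c ⟨$⟩ʳ a) ≡ c
    ga≡c rewrite transpose-applyˡ a c = transpose-fix b′ d
      (λ c≡b′ → a≢b (⟨$⟩ʳ-injective (transpose a c) (trans (transpose-applyˡ a c) c≡b′))) c≢d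

  module TranspositionSet (S : Perm N → Set) (S-transpositions : IsTranspositionSet S)
    (S-generates : Generates S) where
    open IsTranspositionSet S-transpositions

    S-nonempty : ∃ S
    S-nonempty with S-generates (transpose 0F 1F)
    ... | [] , _ , eq = ⊥-elim (0≢1 (trans (sym (transpose-applyʳ 0F 1F)) (eq 1F)))
      where 0≢1 : 0F ≢ 1F
            0≢1 ()
    ... | s ∷ _ , inj₁ Ss ∷ _ , _ = s , Ss
    ... | s ∷ _ , inj₂ Ss⁻¹ ∷ _ , _ = P.flip s , Ss⁻¹

    -- All transpositions are conjugate to one in S, and conjugation commutes with f.
    S-preserving⇒transposition-preserving : (f : Perm N → Perm N) →
      (∀ {x y} → x ≈ₚ y → f x ≈ₚ f y) → (∀ x y → f (x · y) ≈ₚ f x · f y) →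
      (∀ s → S s → S (f s)) → ∀ {a b} → a ≢ b → IsTransposition (f (transpose a b))
    S-preserving⇒transposition-preserving f f-cong f-hom f-S {a} {b} a≢b
      with S-nonempty
    ... | s , Ss with transp s Ss | transp (f s) (f-S s Ss)
    ...   | a₀ , b₀ , a₀≢b₀ , s≈ | c , d , c≢d , fs≈ with transpositions-conjugate a₀≢b₀ a≢b
    ...     | g , ga₀≡a , gb₀≡b =
      f g ⟨$⟩ʳ c , f g ⟨$⟩ʳ d , c≢d ∘ ⟨$⟩ʳ-injective (f g) , λ k → begin
        f (transpose a b) ⟨$⟩ʳ k
          ≡⟨ cong (f (transpose a b) ⟨$⟩ʳ_) (sym (P.inverseʳ (f g))) ⟩
        (f (transpose a b) · f g) ⟨$⟩ʳ (f g ⟨$⟩ˡ k)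
          ≡⟨ sym (f-hom (transpose a b) g _) ⟩
        f (transpose a b · g) ⟨$⟩ʳ (f g ⟨$⟩ˡ k)
          ≡⟨ f-cong g-conj _ ⟩
        f (g · s) ⟨$⟩ʳ (f g ⟨$⟩ˡ k)
          ≡⟨ f-hom g s _ ⟩
        f g ⟨$⟩ʳ (f s ⟨$⟩ʳ (f g ⟨$⟩ˡ k))
          ≡⟨ cong (f g ⟨$⟩ʳ_) (fs≈ _) ⟩
        (f g · transpose c d · P.flip (f g)) ⟨$⟩ʳ k
          ≡⟨ transpose-conjugate′ (f g) c d k ⟩
        transpose (f g ⟨$⟩ʳ c) (f g ⟨$⟩ʳ d) ⟨$⟩ʳ k ∎
      where
      open ≡-Reasoning
      g-conj : transpose a b · g ≈ₚ g · s
      g-conj k = begin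
        transpose a b ⟨$⟩ʳ (g ⟨$⟩ʳ k)
          ≡⟨ cong₂ (λ x y → transpose x y ⟨$⟩ʳ (g ⟨$⟩ʳ k)) (sym ga₀≡a) (sym gb₀≡b) ⟩
        transpose (g ⟨$⟩ʳ a₀) (g ⟨$⟩ʳ b₀) ⟨$⟩ʳ (g ⟨$⟩ʳ k)
          ≡⟨ sym (transpose-conjugate g a₀ b₀ k) ⟩
        g ⟨$⟩ʳ (transpose a₀ b₀ ⟨$⟩ʳ k)
          ≡⟨ cong (g ⟨$⟩ʳ_) (sym (s≈ k)) ⟩
        g ⟨$⟩ʳ (s ⟨$⟩ʳ k) ∎

    conjugation-preserves-S : (h : Perm N → Perm N) (σ : Perm N) → (∀ x → h x ≈ₚ σ · x · P.flip σ) →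
      (∀ s → S s → S (h s)) → ∀ i j → S (transpose i j) → S (transpose (σ ⟨$⟩ʳ i) (σ ⟨$⟩ʳ j))
    conjugation-preserves-S h σ h-conj h-S i j Sij =
      respects (λ k → trans (h-conj (transpose i j) k) (transpose-conjugate′ σ i j k)) (h-S _ Sij)

    -- An automorphism of S_N preserving S in both directions is conjugation by an
    -- automorphism of T(S).
    module S-Automorphism (f g : Perm N → Perm N)
      (f-cong : ∀ {x y} → x ≈ₚ y → f x ≈ₚ f y) (g-cong : ∀ {x y} → x ≈ₚ y → g x ≈ₚ g y)
      (f-hom : ∀ x y → f (x · y) ≈ₚ f x · f y)
      (f∘g≈id : ∀ y → f (g y) ≈ₚ y) (g∘f≈id : ∀ x → g (f x) ≈ₚ x)
      (f-S : ∀ s → S s → S (f s)) (g-S : ∀ s → S s → S (g s))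
      where

      g-hom : ∀ x y → g (x · y) ≈ₚ g x · g y
      g-hom x y k = begin
        g (x · y) ⟨$⟩ʳ k
          ≡⟨ g-cong (λ j → sym (trans (f∘g≈id x _) (cong (x ⟨$⟩ʳ_) (f∘g≈id y j)))) k ⟩
        g (f (g x) · f (g y)) ⟨$⟩ʳ k      ≡⟨ g-cong (sym ∘ f-hom (g x) (g y)) k ⟩
        g (f (g x · g y)) ⟨$⟩ʳ k          ≡⟨ g∘f≈id (g x · g y) k ⟩
        (g x · g y) ⟨$⟩ʳ k                ∎
        where open ≡-Reasoning

      module F = TranspositionPreserving f f-cong f-hom
        (left-invertible⇒injective f g g-cong g∘f≈id)
        (S-preserving⇒transposition-preserving f f-cong f-hom f-S)
      module G = TranspositionPreserving g g-cong g-hom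
        (left-invertible⇒injective g f f-cong f∘g≈id)
        (S-preserving⇒transposition-preserving g g-cong g-hom g-S)

      F∘G-centre≡id : ∀ i → F.centre (G.centre i) ≡ i
      F∘G-centre≡id = intertwines-id⇒id {f = f ∘ g} f∘g≈id
        (intertwines-∘ {f = f} {g = g} F.centre-intertwines G.centre-intertwines)

      G∘F-centre≡id : ∀ i → G.centre (F.centre i) ≡ i
      G∘F-centre≡id = intertwines-id⇒id {f = g ∘ f} g∘f≈id
        (intertwines-∘ {f = g} {g = f} G.centre-intertwines F.centre-intertwines)

      π : Perm N
      π = permutation F.centre G.centre F∘G-centre≡id G∘F-centre≡id

      f-conjugation : ∀ x → f x ≈ₚ π · x · P.flip π
      f-conjugation = intertwines⇒conjugation {f = f} π F.centre-intertwines

      g-conjugation : ∀ x → g x ≈ₚ P.flip π · x · π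
      g-conjugation = intertwines⇒conjugation {f = g} (P.flip π) G.centre-intertwines

      τ : Cayley.AutT N S
      τ = record
        { perm    = π
        ; pres    = conjugation-preserves-S f π f-conjugation f-S
        ; presInv = conjugation-preserves-S g (P.flip π) g-conjugation g-S }

  -- Automorphisms of the Cayley graph

  module CayleyAutomorphisms (S : Perm N → Set) (S-transpositions : IsTranspositionSet S)
    (S-generates : Generates S) (normal : Cayley.IsNormal N S) where
    open Cayley N S
    open TranspositionSet S S-transpositions S-generates
    open IsTranspositionSet S-transpositions
    open RawGroup AutXGroup using () renaming (_≈_ to _≈X_; _∙_ to _∙X_; ε to εX; _⁻¹ to _⁻¹X)
    open RawGroup (rawGroup (SymGroup N) AutTGroup) using ()
      renaming (_≈_ to _≈×_; _∙_ to _∙×_; ε to ε×; _⁻¹ to _⁻¹×)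

    apply : AutX → Perm N → Perm N
    apply φ = Inverse.to (AutX.bij φ)

    record Represents (φ : AutX) (y : Perm N × AutT) : Set where
      constructor represents
      field apply≈ : ∀ x → apply φ x ≈ₚ AutT.perm (proj₂ y) · x · P.flip (proj₁ y)

    module Normalise (φ : AutX) where
      F G : Perm N → Perm N
      F = apply φ
      G = Inverse.from (AutX.bij φ)

      F-cong : ∀ {x y} → x ≈ₚ y → F x ≈ₚ F y
      F-cong = Inverse.to-cong (AutX.bij φ)

      G-cong : ∀ {x y} → x ≈ₚ y → G x ≈ₚ G y
      G-cong = Inverse.from-cong (AutX.bij φ)

      F∘G≈id : ∀ y → F (G y) ≈ₚ y
      F∘G≈id = Inverse.strictlyInverseˡ (AutX.bij φ)

      G∘F≈id : ∀ x → G (F x) ≈ₚ x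
      G∘F≈id = Inverse.strictlyInverseʳ (AutX.bij φ)

      c : Perm N
      c = F P.id

      -- Normality gives F (y · a) = F y · b with b independent of y; y = id identifies b.
      F-translation : ∀ y a → F (y · a) ≈ₚ F y · P.flip c · F a
      F-translation y a with normal φ a
      ... | b , F[G·a]≈·b = λ k → trans (F[y·a]≈ y k) (cong (F y ⟨$⟩ʳ_) (b≈ k))
        where
        F[y·a]≈ : ∀ y → F (y · a) ≈ₚ F y · b
        F[y·a]≈ y k = trans (F-cong {y · a} {G (F y) · a} (λ j → sym (G∘F≈id y (a ⟨$⟩ʳ j))) k)
                            (F[G·a]≈·b (F y) k)
        b≈ : b ≈ₚ P.flip c · F a
        b≈ k = sym (⟨$⟩ʳ⇒⟨$⟩ˡ c (trans (sym (F[y·a]≈ P.id k))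
                                        (F-cong {a} {P.id · a} (λ _ → refl) k)))

      ψ γ : Perm N → Perm N
      ψ x = F x · P.flip c
      γ y = G (y · c)

      ψ-cong : ∀ {x y} → x ≈ₚ y → ψ x ≈ₚ ψ y
      ψ-cong {x} {y} x≈y k = F-cong {x} {y} x≈y (c ⟨$⟩ˡ k)

      γ-cong : ∀ {x y} → x ≈ₚ y → γ x ≈ₚ γ y
      γ-cong {x} {y} x≈y = G-cong {x · c} {y · c} (λ k → x≈y (c ⟨$⟩ʳ k))

      ψ-hom : ∀ x y → ψ (x · y) ≈ₚ ψ x · ψ y
      ψ-hom x y k = F-translation x y (c ⟨$⟩ˡ k)

      ψ∘γ≈id : ∀ y → ψ (γ y) ≈ₚ y
      ψ∘γ≈id y k = trans (F∘G≈id (y · c) (c ⟨$⟩ˡ k)) (cong (y ⟨$⟩ʳ_) (P.inverseʳ c))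

      γ∘ψ≈id : ∀ x → γ (ψ x) ≈ₚ x
      γ∘ψ≈id x k = trans (G-cong {ψ x · c} {F x} (λ j → cong (F x ⟨$⟩ʳ_) (P.inverseˡ c)) k)
                         (G∘F≈id x k)

      ψ-S : ∀ s → S s → S (ψ s)
      ψ-S s Ss with AutX.pres φ P.id s (s , Ss , λ _ → refl)
      ... | t , St , Fs≈t·c =
        respects (λ k → sym (trans (Fs≈t·c (c ⟨$⟩ˡ k)) (cong (t ⟨$⟩ʳ_) (P.inverseʳ c)))) St

      γ-S : ∀ s → S s → S (γ s)
      γ-S s Ss with AutX.presInv φ c (s · c) (s , Ss , λ _ → refl)
      ... | t , St , γs≈t·Gc =
        respects (λ k → sym (trans (γs≈t·Gc k) (cong (t ⟨$⟩ʳ_) (G∘F≈id P.id k)))) St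

      -- (eta-expanded: as bare arguments the implicit permutations are not inferred)
      open S-Automorphism ψ γ (λ {x} {y} → ψ-cong {x} {y}) (λ {x} {y} → γ-cong {x} {y})
        ψ-hom ψ∘γ≈id γ∘ψ≈id ψ-S γ-S using (τ; f-conjugation)

      normal-form : Perm N × AutT
      normal-form = P.flip c · AutT.perm τ , τ

      represented : Represents φ normal-form
      represented = represents λ x k →
        trans (cong (F x ⟨$⟩ʳ_) (sym (P.inverseˡ c))) (f-conjugation x (c ⟨$⟩ʳ k))

    opaque
      Φ : AutX → Perm N × AutT
      Φ φ = Normalise.normal-form φ

      Φ-represents : ∀ φ → Represents φ (Φ φ)
      Φ-represents φ = Normalise.represented φ

    represents-unique : ∀ {φ y y′} → Represents φ y → Represents φ y′ → y ≈× y′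
    represents-unique {y = h , τ} {h′ , τ′} (represents r) (represents r′)
      with translations-unique {τ = AutT.perm τ} {P.flip h} {AutT.perm τ′} {P.flip h′}
             (λ x k → trans (sym (r x k)) (r′ x k))
    ... | τ≈τ′ , h⁻¹≈h′⁻¹ = flip-injective {σ = h} {h′} h⁻¹≈h′⁻¹ , τ≈τ′

    Represents-resp-≈ : ∀ {φ φ′ y} → φ ≈X φ′ → Represents φ′ y → Represents φ y
    Represents-resp-≈ φ≈φ′ (represents r) = represents λ x k → trans (φ≈φ′ x k) (r x k)

    Represents-resp-≈× : ∀ {φ y y′} → y ≈× y′ → Represents φ y → Represents φ y′
    Represents-resp-≈× {y = h , τ} {h′ , τ′} (h≈h′ , τ≈τ′) (represents r) =
      represents λ x k → trans (r x k)
        (trans (τ≈τ′ _) (cong (λ j → AutT.perm τ′ ⟨$⟩ʳ (x ⟨$⟩ʳ j)) (flip-cong {σ = h} {h′} h≈h′ k)))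

    Represents-∙ : ∀ {φ φ′ y y′} → Represents φ y → Represents φ′ y′ →
      Represents (φ ∙X φ′) (y ∙× y′)
    Represents-∙ {φ} {φ′} {h , τ} (represents r) (represents r′) = represents λ x k →
      trans (r (apply φ′ x) k) (cong (AutT.perm τ ⟨$⟩ʳ_) (r′ x (h ⟨$⟩ˡ k)))

    Represents-ε : Represents εX ε×
    Represents-ε = represents λ x k → refl

    Represents-⁻¹ : ∀ {φ y} → Represents φ y → Represents (φ ⁻¹X) (y ⁻¹×)
    Represents-⁻¹ {φ} {h , τ} (represents r) = represents λ y k → begin
      G y ⟨$⟩ʳ k                      ≡⟨ G-cong {y} {F (σ⁻¹ · y · h)} (λ j → sym (F[x]≈y y j)) k ⟩
      G (F (σ⁻¹ · y · h)) ⟨$⟩ʳ k      ≡⟨ G∘F≈id (σ⁻¹ · y · h) k ⟩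
      (σ⁻¹ · y · h) ⟨$⟩ʳ k            ∎
      where
      open ≡-Reasoning
      open Normalise φ using (F; G; G-cong; G∘F≈id)
      σ σ⁻¹ : Perm N
      σ = AutT.perm τ
      σ⁻¹ = P.flip σ
      F[x]≈y : ∀ y → F (σ⁻¹ · y · h) ≈ₚ y
      F[x]≈y y j = begin
        F (σ⁻¹ · y · h) ⟨$⟩ʳ j                        ≡⟨ r (σ⁻¹ · y · h) j ⟩
        σ ⟨$⟩ʳ (σ ⟨$⟩ˡ (y ⟨$⟩ʳ (h ⟨$⟩ʳ (h ⟨$⟩ˡ j))))  ≡⟨ P.inverseʳ σ ⟩
        y ⟨$⟩ʳ (h ⟨$⟩ʳ (h ⟨$⟩ˡ j))                    ≡⟨ cong (y ⟨$⟩ʳ_) (P.inverseʳ h) ⟩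
        y ⟨$⟩ʳ j                                     ∎

    translate-preserves-adjacency : (σ : Perm N) → (∀ i j → AdjT i j → AdjT (σ ⟨$⟩ʳ i) (σ ⟨$⟩ʳ j)) →
      ∀ η a b → AdjX a b → AdjX (σ · a · η) (σ · b · η)
    translate-preserves-adjacency σ σ-pres η a b (s , Ss , b≈s·a) with transp s Ss
    ... | i , j , _ , s≈ = transpose (σ ⟨$⟩ʳ i) (σ ⟨$⟩ʳ j) , σ-pres i j (respects s≈ Ss) ,
      λ k → trans (cong (σ ⟨$⟩ʳ_) (trans (b≈s·a (η ⟨$⟩ʳ k)) (s≈ _))) (transpose-conjugate σ i j _)

    realise : Perm N × AutT → AutX
    realise (h , τ) = record
      { bij = record
        { to        = λ x → σ · x · P.flip h
        ; from      = λ y → P.flip σ · y · h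
        ; to-cong   = λ x≈y k → cong (σ ⟨$⟩ʳ_) (x≈y _)
        ; from-cong = λ x≈y k → cong (σ ⟨$⟩ˡ_) (x≈y _)
        ; inverse   = (λ {y} y≈ k → trans (cong (σ ⟨$⟩ʳ_) (y≈ _))
                                     (trans (P.inverseʳ σ) (cong (y ⟨$⟩ʳ_) (P.inverseʳ h))))
                    , (λ {x} x≈ k → trans (cong (σ ⟨$⟩ˡ_) (x≈ _))
                                     (trans (P.inverseˡ σ) (cong (x ⟨$⟩ʳ_) (P.inverseˡ h)))) }
      ; pres    = translate-preserves-adjacency σ (AutT.pres τ) (P.flip h)
      ; presInv = translate-preserves-adjacency (P.flip σ) (AutT.presInv τ) h }
      where σ = AutT.perm τ

    Φ-cong : ∀ {φ φ′} → φ ≈X φ′ → Φ φ ≈× Φ φ′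
    Φ-cong {φ} {φ′} φ≈φ′ =
      represents-unique (Φ-represents φ) (Represents-resp-≈ {φ′ = φ′} φ≈φ′ (Φ-represents φ′))

    Φ-homo : ∀ φ φ′ → Φ (φ ∙X φ′) ≈× Φ φ ∙× Φ φ′
    Φ-homo φ φ′ =
      represents-unique (Φ-represents (φ ∙X φ′)) (Represents-∙ (Φ-represents φ) (Φ-represents φ′))

    Φ-ε : Φ εX ≈× ε×
    Φ-ε = represents-unique (Φ-represents εX) Represents-ε

    Φ-⁻¹ : ∀ φ → Φ (φ ⁻¹X) ≈× Φ φ ⁻¹×
    Φ-⁻¹ φ = represents-unique (Φ-represents (φ ⁻¹X)) (Represents-⁻¹ (Φ-represents φ))

    Φ-injective : ∀ {φ φ′} → Φ φ ≈× Φ φ′ → φ ≈X φ′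
    Φ-injective {φ} {φ′} Φφ≈Φφ′ x k =
      trans (Represents.apply≈ (Represents-resp-≈× {y′ = Φ φ′} Φφ≈Φφ′ (Φ-represents φ)) x k)
            (sym (Represents.apply≈ (Φ-represents φ′) x k))

    Φ-realise : ∀ {φ} y → φ ≈X realise y → Φ φ ≈× y
    Φ-realise {φ} y φ≈ = represents-unique (Φ-represents φ)
      (Represents-resp-≈ {φ′ = realise y} {y = y} φ≈ (represents λ _ _ → refl))

    Φ-isGroupIsomorphism :
      GroupMorphisms.IsGroupIsomorphism AutXGroup (rawGroup (SymGroup N) AutTGroup) Φ
    Φ-isGroupIsomorphism = record
      { isGroupMonomorphism = record
        { isGroupHomomorphism = record
          { isMonoidHomomorphism = record
            { isMagmaHomomorphism = record
              { isRelHomomorphism = record { cong = Φ-cong }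
              ; homo = Φ-homo }
            ; ε-homo = Φ-ε }
          ; ⁻¹-homo = Φ-⁻¹ }
        ; injective = Φ-injective }
      ; surjective = λ y → realise y , Φ-realise y }

theorem2 : (n : ℕ) → 3 ≤ n → (S : Perm n → Set) →
    IsTranspositionSet S → Generates S → Cayley.IsNormal n S →
    ∃ λ Φ → GroupMorphisms.IsGroupIsomorphism (Cayley.AutXGroup n S)
      (rawGroup (SymGroup n) (Cayley.AutTGroup n S)) Φ
theorem2 (suc (suc (suc m))) (s≤s (s≤s (s≤s z≤n))) S S-transpositions S-generates normal =
  Φ , Φ-isGroupIsomorphism
  where open CayleyAutomorphisms S S-transpositions S-generates normal
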